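{- Let $T_2^1=\begin{bmatrix}0&1\\1&0\end{bmatrix}$. For every $n\ge 2$, $\mathrm{sat}(n,T_2^1)=\mathrm{forb}(n,T_2^1)=n+1$.
   Context: All matrices are $0$-$1$ matrices. A matrix is simple if it has no repeated columns. A matrix $F$ is a submatrix of $A$ if, after deleting some rows and columns of $A$, one obtains a row and column permutation of $F$. $\mathrm{forb}(n,F)$ is the maximum number of columns of a simple $n$-row matrix not containing $F$ as a submatrix. A simple $n$-row matrix $M$ is $F$-saturated if it does not contain $F$ but appending any $n$-column not already a column of $M$ produces a matrix containing $F$; $\mathrm{sat}(n,F)$ is the minimum number of columns of an $F$-saturated $n$-row matrix. -}

module Defs where

open import Data.Bool using (Bool; true; false)
open import Data.Nat using (ℕ; suc; _≤_)
open import Data.Fin using (Fin; zero; suc)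
open import Data.Vec using (Vec; []; _∷_; lookup)
import Data.Vec.Functional as VF
open import Data.Product using (Σ; ∃; _×_; _,_)
open import Relation.Binary.PropositionalEquality using (_≡_)
open import Relation.Nullary using (¬_)
open import Function.Definitions using (Injective)

-- A 0-1 matrix with k rows and l columns, given by its list of columns:
-- column j is a vector of k booleans (false = 0, true = 1).
Matrix : ℕ → ℕ → Set
Matrix k l = Fin l → Vec Bool k

Simple : ∀ {n m} → Matrix n m → Set
Simple A = Injective _≡_ _≡_ A

-- F (k×l) is a submatrix of A (n×m): there are distinct rows r(0..k-1) and
-- distinct columns c(0..l-1) of A (in any order, which accounts for row and
-- column permutations of F) such that A restricted to them equals F.
Contains : ∀ {n m k l} → Matrix n m → Matrix k l → Set
Contains {n} {m} {k} {l} A F =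
  Σ (Fin k → Fin n) λ r → Σ (Fin l → Fin m) λ c →
    Injective _≡_ _≡_ r × Injective _≡_ _≡_ c ×
    (∀ (i : Fin k) (j : Fin l) → lookup (A (c j)) (r i) ≡ lookup (F j) i)

IsColumn : ∀ {n m} → Vec Bool n → Matrix n m → Set
IsColumn v A = ∃ λ j → A j ≡ v

append : ∀ {n m} → Matrix n m → Vec Bool n → Matrix n (suc m)
append A v = v VF.∷ A

Saturated : ∀ {n m k l} → Matrix k l → Matrix n m → Set
Saturated {n} F M =
  Simple M × ¬ Contains M F ×
  (∀ (v : Vec Bool n) → ¬ IsColumn v M → Contains (append M v) F)

ForbIs : ∀ {k l} → ℕ → Matrix k l → ℕ → Set
ForbIs n F N =
  (Σ (Matrix n N) λ A → Simple A × ¬ Contains A F) ×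
  (∀ m (A : Matrix n m) → Simple A → ¬ Contains A F → m ≤ N)

SatIs : ∀ {k l} → ℕ → Matrix k l → ℕ → Set
SatIs n F N =
  (Σ (Matrix n N) λ M → Saturated F M) ×
  (∀ m (M : Matrix n m) → Saturated F M → N ≤ m)

T21 : Matrix 2 2
T21 zero = false ∷ true ∷ []
T21 (suc zero) = true ∷ false ∷ []

module Submission where

-- Columns of an n-row 0-1 matrix are vectors in the Boolean lattice {0,1}ⁿ,
-- ordered entrywise (a ⊑ b).  Two columns realise T₂¹ = [[0,1],[1,0]] exactly
-- when they are incomparable, so a matrix avoids T₂¹ iff its columns form a
-- chain, and it is T₂¹-saturated iff its columns form a maximal chain.
--
--  * forb: distinct comparable vectors have distinct weights (numbers of 1s),
--    and there are only n+1 weights, so a simple chain has ≤ n+1 columns.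
--  * the threshold matrix with columns 0ⁿ, 10ⁿ⁻¹, 110ⁿ⁻², …, 1ⁿ is a chain of
--    n+1 columns, and every other vector is incomparable with one of them;
--    so it is saturated, and witnesses both values.
--  * sat: a maximal chain contains 0ⁿ and 1ⁿ, and between a column u and a
--    higher column w it contains a column of weight |u|+1 (take v of weight
--    |u|+1 with u ⊑ v ⊑ w; if v is not a column, a column incomparable with v
--    lies strictly between u and w, and we descend).  Hence it has a column of
--    every weight 0,…,n, i.e. at least n+1 columns.

open import Defs
open import Data.Nat using (ℕ; zero; suc; _≤_; _<_; z≤n; s≤s; s≤s⁻¹)
open import Data.Nat.Properties
  using (≤-reflexive; m≤n⇒m≤1+n; <⇒≤; <⇒≱; ≤∧≢⇒<)
open import Data.Nat.Induction using (<-wellFounded)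
open import Induction.WellFounded using (Acc; acc)
open import Data.Bool using (Bool; true; false)
open import Data.Fin using (Fin; toℕ; fromℕ<) renaming (zero to fz; suc to fs)
open import Data.Fin.Properties using (any?; injective⇒≤; toℕ-injective; toℕ-fromℕ<; toℕ≤pred[n])
open import Data.Vec using (Vec; []; _∷_; lookup; tail)
open import Data.Vec.Properties using (≡-dec)
open import Data.Product using (_×_; ∃; _,_; proj₁; proj₂)
open import Data.Sum using (_⊎_; inj₁; inj₂)
open import Data.Empty using (⊥-elim)
open import Relation.Nullary using (¬_; yes; no)
open import Relation.Binary.PropositionalEquality
  using (_≡_; _≢_; refl; sym; trans; cong; subst; subst₂)
open import Function.Definitions using (Injective)
import Data.Bool.Properties as BoolP

data _⊑_ : ∀ {n} → Vec Bool n → Vec Bool n → Set where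
  []⊑[] : [] ⊑ []
  0⊑_   : ∀ {n x} {a b : Vec Bool n} → a ⊑ b → (false ∷ a) ⊑ (x ∷ b)
  1⊑1   : ∀ {n} {a b : Vec Bool n} → a ⊑ b → (true ∷ a) ⊑ (true ∷ b)

Comparable : ∀ {n} → Vec Bool n → Vec Bool n → Set
Comparable a b = a ⊑ b ⊎ b ⊑ a

weight : ∀ {n} → Vec Bool n → ℕ
weight [] = 0
weight (false ∷ a) = weight a
weight (true ∷ a) = suc (weight a)

⊑-refl : ∀ {n} (a : Vec Bool n) → a ⊑ a
⊑-refl [] = []⊑[]
⊑-refl (false ∷ a) = 0⊑ ⊑-refl a
⊑-refl (true ∷ a) = 1⊑1 (⊑-refl a)

⊑-trans : ∀ {n} {a b c : Vec Bool n} → a ⊑ b → b ⊑ c → a ⊑ c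
⊑-trans []⊑[] []⊑[] = []⊑[]
⊑-trans (0⊑ p) (0⊑ q) = 0⊑ ⊑-trans p q
⊑-trans (0⊑ p) (1⊑1 q) = 0⊑ ⊑-trans p q
⊑-trans (1⊑1 p) (1⊑1 q) = 1⊑1 (⊑-trans p q)

weight≤length : ∀ {n} (a : Vec Bool n) → weight a ≤ n
weight≤length [] = z≤n
weight≤length (false ∷ a) = m≤n⇒m≤1+n (weight≤length a)
weight≤length (true ∷ a) = s≤s (weight≤length a)

⊑-weight : ∀ {n} {a b : Vec Bool n} → a ⊑ b → weight a ≤ weight b
⊑-weight []⊑[] = z≤n
⊑-weight (0⊑_ {x = false} p) = ⊑-weight p
⊑-weight (0⊑_ {x = true} p) = m≤n⇒m≤1+n (⊑-weight p)
⊑-weight (1⊑1 p) = s≤s (⊑-weight p)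

⊑-weight-antisym : ∀ {n} {a b : Vec Bool n} → a ⊑ b → weight b ≤ weight a → a ≡ b
⊑-weight-antisym []⊑[] _ = refl
⊑-weight-antisym (0⊑_ {x = false} p) q = cong (false ∷_) (⊑-weight-antisym p q)
⊑-weight-antisym (0⊑_ {x = true} p) q = ⊥-elim (<⇒≱ (s≤s (⊑-weight p)) q)
⊑-weight-antisym (1⊑1 p) q = cong (true ∷_) (⊑-weight-antisym p (s≤s⁻¹ q))

⊏-weight : ∀ {n} {a b : Vec Bool n} → a ⊑ b → a ≢ b → weight a < weight b
⊏-weight p a≢b = ≤∧≢⇒< (⊑-weight p) (λ e → a≢b (⊑-weight-antisym p (≤-reflexive (sym e))))

comparable-weight-injective : ∀ {n} {a b : Vec Bool n} →
  Comparable a b → weight a ≡ weight b → a ≡ b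
comparable-weight-injective (inj₁ p) e = ⊑-weight-antisym p (≤-reflexive (sym e))
comparable-weight-injective (inj₂ p) e = sym (⊑-weight-antisym p (≤-reflexive e))

⊑-lookup : ∀ {n} {a b : Vec Bool n} → a ⊑ b → ∀ i → lookup a i ≡ true → lookup b i ≡ true
⊑-lookup (0⊑ p) fz ()
⊑-lookup (0⊑ p) (fs i) e = ⊑-lookup p i e
⊑-lookup (1⊑1 p) fz e = refl
⊑-lookup (1⊑1 p) (fs i) e = ⊑-lookup p i e

⊑-or-witness : ∀ {n} (a b : Vec Bool n) →
  a ⊑ b ⊎ ∃ λ i → lookup a i ≡ true × lookup b i ≡ false
⊑-or-witness [] [] = inj₁ []⊑[]
⊑-or-witness (x ∷ a) (y ∷ b) with ⊑-or-witness a b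
... | inj₂ (i , p , q) = inj₂ (fs i , p , q)
⊑-or-witness (false ∷ a) (y ∷ b) | inj₁ p = inj₁ (0⊑ p)
⊑-or-witness (true ∷ a) (true ∷ b) | inj₁ p = inj₁ (1⊑1 p)
⊑-or-witness (true ∷ a) (false ∷ b) | inj₁ p = inj₂ (fz , refl , refl)

zeros : ∀ n → Vec Bool n
zeros zero = []
zeros (suc n) = false ∷ zeros n

ones : ∀ n → Vec Bool n
ones zero = []
ones (suc n) = true ∷ ones n

zeros⊑ : ∀ {n} (a : Vec Bool n) → zeros n ⊑ a
zeros⊑ [] = []⊑[]
zeros⊑ (x ∷ a) = 0⊑ zeros⊑ a

⊑ones : ∀ {n} (a : Vec Bool n) → a ⊑ ones n
⊑ones [] = []⊑[]
⊑ones (false ∷ a) = 0⊑ ⊑ones a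
⊑ones (true ∷ a) = 1⊑1 (⊑ones a)

weight-zeros : ∀ n → weight (zeros n) ≡ 0
weight-zeros zero = refl
weight-zeros (suc n) = weight-zeros n

weight-ones : ∀ n → weight (ones n) ≡ n
weight-ones zero = refl
weight-ones (suc n) = cong suc (weight-ones n)

cover-step : ∀ {n} {u w : Vec Bool n} → u ⊑ w → weight u < weight w →
  ∃ λ v → u ⊑ v × v ⊑ w × weight v ≡ suc (weight u)
cover-step (0⊑_ {x = true} {a} p) _ = true ∷ a , 0⊑ ⊑-refl a , 1⊑1 p , refl
cover-step (0⊑_ {x = false} p) lt with cover-step p lt
... | v , u⊑v , v⊑w , e = false ∷ v , 0⊑ u⊑v , 0⊑ v⊑w , e
cover-step (1⊑1 p) lt with cover-step p (s≤s⁻¹ lt)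
... | v , u⊑v , v⊑w , e = true ∷ v , 1⊑1 u⊑v , 1⊑1 v⊑w , cong suc e

-- A witness of incomparability: rows r0, r1 in which a reads (0,1) and b
-- reads (1,0).  Such pairs of columns are exactly the copies of T₂¹.
data Incomparable {n} (a b : Vec Bool n) : Set where
  rows : ∀ r0 r1 → lookup a r0 ≡ false → lookup a r1 ≡ true →
         lookup b r0 ≡ true → lookup b r1 ≡ false → Incomparable a b

Incomparable-sym : ∀ {n} {a b : Vec Bool n} → Incomparable a b → Incomparable b a
Incomparable-sym (rows r0 r1 a0 a1 b0 b1) = rows r1 r0 b1 b0 a1 a0

Incomparable-irrefl : ∀ {n} {a : Vec Bool n} → ¬ Incomparable a a
Incomparable-irrefl (rows r0 r1 a0 a1 b0 b1) with trans (sym a0) b0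
... | ()

Incomparable-⊑ : ∀ {n} {a b : Vec Bool n} → Incomparable a b → ¬ a ⊑ b
Incomparable-⊑ (rows r0 r1 a0 a1 b0 b1) a⊑b with trans (sym b1) (⊑-lookup a⊑b r1 a1)
... | ()

Incomparable⇒¬Comparable : ∀ {n} {a b : Vec Bool n} → Incomparable a b → ¬ Comparable a b
Incomparable⇒¬Comparable i (inj₁ a⊑b) = Incomparable-⊑ i a⊑b
Incomparable⇒¬Comparable i (inj₂ b⊑a) = Incomparable-⊑ (Incomparable-sym i) b⊑a

¬Incomparable⇒Comparable : ∀ {n} (a b : Vec Bool n) → ¬ Incomparable a b → Comparable a b
¬Incomparable⇒Comparable a b ¬i with ⊑-or-witness a b | ⊑-or-witness b a
... | inj₁ a⊑b | _ = inj₁ a⊑b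
... | inj₂ _ | inj₁ b⊑a = inj₂ b⊑a
... | inj₂ (i , ai , bi) | inj₂ (j , bj , aj) = ⊥-elim (¬i (rows j i aj ai bj bi))

contains⇒incomparable : ∀ {n m} (A : Matrix n m) →
  Contains A T21 → ∃ λ j → ∃ λ j' → Incomparable (A j) (A j')
contains⇒incomparable A (r , c , _ , _ , e) =
  c fz , c (fs fz) , rows (r fz) (r (fs fz)) (e fz fz) (e (fs fz) fz) (e fz (fs fz)) (e (fs fz) (fs fz))

pair : ∀ {X : Set} → X → X → Fin 2 → X
pair x y fz = x
pair x y (fs fz) = y

pair-injective : ∀ {X : Set} {x y : X} → x ≢ y → Injective _≡_ _≡_ (pair x y)
pair-injective x≢y {fz} {fz} _ = refl
pair-injective x≢y {fz} {fs fz} e = ⊥-elim (x≢y e)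
pair-injective x≢y {fs fz} {fz} e = ⊥-elim (x≢y (sym e))
pair-injective x≢y {fs fz} {fs fz} _ = refl

incomparable⇒contains : ∀ {n m} (A : Matrix n m) j j' →
  Incomparable (A j) (A j') → Contains A T21
incomparable⇒contains A j j' i@(rows r0 r1 a0 a1 b0 b1) =
  pair r0 r1 , pair j j' ,
  pair-injective r0≢r1 ,
  pair-injective (λ e → Incomparable-irrefl (subst (λ k → Incomparable (A j) (A k)) (sym e) i)) ,
  λ { fz fz → a0 ; (fs fz) fz → a1 ; fz (fs fz) → b0 ; (fs fz) (fs fz) → b1 }
  where
  r0≢r1 : r0 ≢ r1
  r0≢r1 refl with trans (sym a0) a1
  ... | ()

free⇒chain : ∀ {n m} (A : Matrix n m) → ¬ Contains A T21 → ∀ j j' → Comparable (A j) (A j')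
free⇒chain A free j j' = ¬Incomparable⇒Comparable _ _ (λ i → free (incomparable⇒contains A j j' i))

chain⇒free : ∀ {n m} (A : Matrix n m) → (∀ j j' → Comparable (A j) (A j')) → ¬ Contains A T21
chain⇒free A chain c with contains⇒incomparable A c
... | j , j' , i = Incomparable⇒¬Comparable i (chain j j')

weightFin : ∀ {n} → Vec Bool n → Fin (suc n)
weightFin a = fromℕ< (s≤s (weight≤length a))

-- forb(n, T₂¹) ≤ n+1: columns of a simple T₂¹-free matrix are told apart by
-- their weights.
forb-upper : ∀ {n} m (A : Matrix n m) → Simple A → ¬ Contains A T21 → m ≤ suc n
forb-upper m A simple free = injective⇒≤ {f = λ j → weightFin (A j)} weights-distinct
  where
  weights-distinct : Injective _≡_ _≡_ (λ j → weightFin (A j))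
  weights-distinct {j} {j'} e = simple (comparable-weight-injective (free⇒chain A free j j') same-weight)
    where
    same-weight : weight (A j) ≡ weight (A j')
    same-weight = trans (sym (toℕ-fromℕ< _)) (trans (cong toℕ e) (toℕ-fromℕ< _))

-- The threshold matrix, with column k equal to 1ᵏ0ⁿ⁻ᵏ; it is a saturated
-- chain with n+1 columns.
threshold : ∀ n → Matrix n (suc n)
threshold zero fz = []
threshold (suc n) fz = false ∷ threshold n fz
threshold (suc n) (fs k) = true ∷ threshold n k

threshold-simple : ∀ n → Simple (threshold n)
threshold-simple zero {fz} {fz} _ = refl
threshold-simple (suc n) {fz} {fz} _ = refl
threshold-simple (suc n) {fz} {fs y} ()
threshold-simple (suc n) {fs x} {fz} ()
threshold-simple (suc n) {fs x} {fs y} e = cong fs (threshold-simple n (cong tail e))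

threshold-zero⊑ : ∀ n (k : Fin (suc n)) → threshold n fz ⊑ threshold n k
threshold-zero⊑ zero fz = []⊑[]
threshold-zero⊑ (suc n) fz = 0⊑ threshold-zero⊑ n fz
threshold-zero⊑ (suc n) (fs k) = 0⊑ threshold-zero⊑ n k

threshold-chain : ∀ n (k k' : Fin (suc n)) → Comparable (threshold n k) (threshold n k')
threshold-chain n fz k' = inj₁ (threshold-zero⊑ n k')
threshold-chain (suc n) (fs k) fz = inj₂ (threshold-zero⊑ (suc n) (fs k))
threshold-chain (suc n) (fs k) (fs k') with threshold-chain n k k'
... | inj₁ p = inj₁ (1⊑1 p)
... | inj₂ p = inj₂ (1⊑1 p)

IsMaximalFor : ∀ {n m} → Matrix n m → Vec Bool n → Set
IsMaximalFor M v = IsColumn v M ⊎ ∃ λ k → Incomparable v (M k)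

-- Prefixing 0 to column k: it is column 0 again, or it reads (0,1) against
-- column 1 = (1,0,…) in its top two rows.
zero-prefix : ∀ {n} (k : Fin (suc n)) → IsMaximalFor (threshold (suc n)) (false ∷ threshold n k)
zero-prefix fz = inj₁ (fz , refl)
zero-prefix {suc n} (fs k) = inj₂ (fs fz , rows fz (fs fz) refl refl refl refl)

-- Every vector is blocked by the threshold columns (a 0 above a 1 in v is
-- found by zero-prefix at the lowest 0 that has a 1 below it).
threshold-maximal : ∀ {n} (v : Vec Bool n) → IsMaximalFor (threshold n) v
threshold-maximal [] = inj₁ (fz , refl)
threshold-maximal (false ∷ v) with threshold-maximal v
... | inj₁ (k , refl) = zero-prefix k
... | inj₂ (k , rows r0 r1 a0 a1 b0 b1) = inj₂ (fs k , rows (fs r0) (fs r1) a0 a1 b0 b1)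
threshold-maximal (true ∷ v) with threshold-maximal v
... | inj₁ (k , refl) = inj₁ (fs k , refl)
... | inj₂ (k , rows r0 r1 a0 a1 b0 b1) = inj₂ (fs k , rows (fs r0) (fs r1) a0 a1 b0 b1)

threshold-free : ∀ n → ¬ Contains (threshold n) T21
threshold-free n = chain⇒free (threshold n) (threshold-chain n)

threshold-saturated : ∀ n → Saturated T21 (threshold n)
threshold-saturated n = threshold-simple n , threshold-free n , saturate
  where
  saturate : ∀ v → ¬ IsColumn v (threshold n) → Contains (append (threshold n) v) T21
  saturate v ¬col with threshold-maximal v
  ... | inj₁ col = ⊥-elim (¬col col)
  ... | inj₂ (k , i) = incomparable⇒contains (append (threshold n) v) fz (fs k) i

strictly-between : ∀ {n} {u v w c : Vec Bool n} → u ⊑ v → v ⊑ w →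
  Incomparable v c → Comparable c u → Comparable c w →
  u ⊑ c × c ⊑ w × weight u < weight c × weight c < weight w
strictly-between u⊑v v⊑w i (inj₁ c⊑u) _ =
  ⊥-elim (Incomparable-⊑ (Incomparable-sym i) (⊑-trans c⊑u u⊑v))
strictly-between u⊑v v⊑w i _ (inj₂ w⊑c) = ⊥-elim (Incomparable-⊑ i (⊑-trans v⊑w w⊑c))
strictly-between {c = c} u⊑v v⊑w i (inj₂ u⊑c) (inj₁ c⊑w) =
  u⊑c , c⊑w , ⊏-weight u⊑c u≢c , ⊏-weight c⊑w c≢w
  where
  u≢c : _ ≢ c
  u≢c refl = Incomparable-⊑ (Incomparable-sym i) u⊑v
  c≢w : c ≢ _
  c≢w refl = Incomparable-⊑ i v⊑w

-- sat(n, T₂¹) ≥ n+1: the columns of a saturated matrix form a maximal chain,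
-- which contains a column of every weight.
module Saturated-lower {n m} (M : Matrix n m) (saturated : Saturated T21 M) where
  chain : ∀ j j' → Comparable (M j) (M j')
  chain = free⇒chain M (proj₁ (proj₂ saturated))

  column-or-incomparable : ∀ v → IsMaximalFor M v
  column-or-incomparable v with any? (λ j → ≡-dec BoolP._≟_ (M j) v)
  ... | yes col = inj₁ col
  ... | no ¬col with contains⇒incomparable (append M v) (proj₂ (proj₂ saturated) v ¬col)
  ... | fz , fz , i = ⊥-elim (Incomparable-irrefl i)
  ... | fz , fs j , i = inj₂ (j , i)
  ... | fs j , fz , i = inj₂ (j , Incomparable-sym i)
  ... | fs j , fs j' , i = ⊥-elim (Incomparable⇒¬Comparable i (chain j j'))

  comparable-to-all⇒column : ∀ v → (∀ j → Comparable v (M j)) → IsColumn v M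
  comparable-to-all⇒column v cmp with column-or-incomparable v
  ... | inj₁ col = col
  ... | inj₂ (j , i) = ⊥-elim (Incomparable⇒¬Comparable i (cmp j))

  next-weight : ∀ ju jw → Acc _<_ (weight (M jw)) →
    M ju ⊑ M jw → weight (M ju) < weight (M jw) → ∃ λ j → weight (M j) ≡ suc (weight (M ju))
  next-weight ju jw (acc descend) u⊑w u<w with cover-step u⊑w u<w
  ... | v , u⊑v , v⊑w , |v| with column-or-incomparable v
  ...   | inj₁ (j , Mj≡v) = j , trans (cong weight Mj≡v) |v|
  ...   | inj₂ (jc , i) with strictly-between u⊑v v⊑w i (chain jc ju) (chain jc jw)
  ...     | u⊑c , _ , u<c , c<w = next-weight ju jc (descend c<w) u⊑c u<c

  column-of-weight : ∀ k → k ≤ n → ∃ λ j → weight (M j) ≡ k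
  column-of-weight zero _ with comparable-to-all⇒column (zeros n) (λ j → inj₁ (zeros⊑ (M j)))
  ... | j , Mj≡0 = j , trans (cong weight Mj≡0) (weight-zeros n)
  column-of-weight (suc k) k<n with column-of-weight k (<⇒≤ k<n)
  ... | ju , |u|≡k with comparable-to-all⇒column (ones n) (λ j → inj₂ (⊑ones (M j)))
  ... | jw , Mw≡1 with next-weight ju jw (<-wellFounded _) u⊑w u<w
    where
    u⊑w : M ju ⊑ M jw
    u⊑w = subst (M ju ⊑_) (sym Mw≡1) (⊑ones (M ju))
    u<w : weight (M ju) < weight (M jw)
    u<w = subst₂ _<_ (sym |u|≡k) (sym (trans (cong weight Mw≡1) (weight-ones n))) k<n
  ... | j , |j| = j , trans |j| (cong suc |u|≡k)

  sat-lower : suc n ≤ m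
  sat-lower = injective⇒≤ {f = pick} distinct
    where
    pick : Fin (suc n) → Fin m
    pick k = proj₁ (column-of-weight (toℕ k) (toℕ≤pred[n] k))
    distinct : Injective _≡_ _≡_ pick
    distinct {k} {k'} e = toℕ-injective
      (trans (sym (proj₂ (column-of-weight (toℕ k) (toℕ≤pred[n] k))))
        (trans (cong (λ j → weight (M j)) e) (proj₂ (column-of-weight (toℕ k') (toℕ≤pred[n] k')))))

-- The threshold matrix attains both bounds.
mainTheorem9 : ∀ (n : ℕ) → 2 ≤ n → SatIs n T21 (suc n) × ForbIs n T21 (suc n)
mainTheorem9 n _ =
  ((threshold n , threshold-saturated n) , λ m M sat → Saturated-lower.sat-lower M sat) ,
  ((threshold n , threshold-simple n , threshold-free n) , forb-upper)
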